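{- Let $\mathcal T$ be a tower diagram and $c$ a top cell of $\mathcal T$ with generalized flight number $\mathrm{gfn}(\mathcal T,c)=(i,j)$ (so $i\le j$). Let $\mathcal T-c$ be the diagram obtained by removing $c$ from $\mathcal T$. Then $\mathfrak h_{i,j}\searrow(\mathcal T-c)=\mathcal T$. Moreover, if $\omega$ is a permutation with $\mathcal T_\omega=\mathcal T-c$, then $\mathcal T_{\omega\cdot t_{i,j+1}}=\mathcal T$.
   Context: Permutations compose as functions; $t_{a,b}$ is the transposition of $a,b$; $s_p=t_{p,p+1}$. A tower diagram is a sequence $\mathcal T=(\mathcal T_1,\mathcal T_2,\ldots)$ of nonnegative integers, almost all zero. A cell is identified with the south-east corner $(a,b)$ ($a\ge1,b\ge0$) of $[a-1,a]\times[b,b+1]$; $(a,b)\in\mathcal T$ iff $b<\mathcal T_a$; its slide is $\mathrm{sl}(a,b)=a+b$. A top cell is a cell $(p,\mathcal T_p-1)$ with $\mathcal T_p>0$. Sliding $i$ into $\mathcal T$: set $s:=i$, examine towers $p=1,2,\ldots$ with $h=\mathcal T_p$: if $s>p+h$ go on; if $s=p+h$ increase $\mathcal T_p$ by one and stop; if $h\ge1$ and $s=p+h-1$ decrease $\mathcal T_p$ by one and stop; if $s<p+h-1$ set $s:=s+1$ and go on. Words are slid letter by letter from left to right. $\mathcal T_\omega$ is the result of sliding a reduced word $\alpha_1\cdots\alpha_l$ of $\omega=s_{\alpha_1}\cdots s_{\alpha_l}$ into the empty diagram. For $i\le j$, $\mathfrak h_{i,j}\searrow\mathcal D$ denotes the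 result of sliding the word $j,\,j-1,\ldots,i+1,\,i,\,i+1,\ldots,j$ (corresponding to $t_{i,j+1}=s_j\cdots s_{i+1}s_is_{i+1}\cdots s_j$) into $\mathcal D$. Flight path: for $c=(a,b)$, $\mathrm{fp}(\mathcal T,c)=\{c\}$ if $a=1$; otherwise with $d=(a-1,b)$, $e=(a-1,b+1)$, $\mathrm{fp}(\mathcal T,c)=\mathrm{fp}(\mathcal T,d)\cup\{c\}$ if $d\in\mathcal T$, else $\mathrm{fp}(\mathcal T,e)\cup\{c\}$. Write its cells as $c_1,\ldots,c_p=c$ from left to right ($c_1$ in column 1); the flight number is $\mathrm{fn}(\mathcal T,c)=\mathrm{sl}(c_1)$. Hook number: put $n_p=0$ and for $q=p,\ldots,2$: $n_{q-1}=n_q$ if $c_{q-1}\notin\mathcal T$; if $c_{q-1}\in\mathcal T$, let $h$ be the number of cells of $\mathcal T$ strictly above $c_{q-1}$ in its column, and set $n_{q-1}=n_q$ if $h>n_q$, $n_{q-1}=n_q+1$ if $h\le n_q$. Then $\mathrm{hn}(\mathcal T,c)=n_1+\mathrm{sl}(c_1)$ and $\mathrm{gfn}(\mathcal T,c)=(\mathrm{fn}(\mathcal T,c),\mathrm{hn}(\mathcal T,c))$. -}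

module Defs where

open import Data.Nat using (ℕ; zero; suc; _<ᵇ_; _+_; _∸_; _≤_; _<_; _<?_; _≟_)
open import Data.Nat.Properties using (<-cmp)
open import Data.Product using (_×_; _,_; proj₁; proj₂)
open import Data.List using (List; []; _∷_; _∷ʳ_; replicate; length; foldr; _++_; map)
open import Data.List.Relation.Unary.All using (All)
open import Relation.Binary using (Tri; tri<; tri≈; tri>)
open import Relation.Binary.PropositionalEquality using (_≡_)
open import Relation.Nullary using (yes; no)
open import Data.Bool using (if_then_else_)

-- A tower diagram (T₁, T₂, …) (almost all zero) is represented by a
-- finite list [T₁, …, Tₙ]; all heights beyond the list are 0.
-- Two lists represent the same diagram iff all heights agree (_≈ᵀ_).

Diagram : Set
Diagram = List ℕ

-- height T a = T_a  (columns are 1-based; column 0 does not exist, 0 there)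
height : Diagram → ℕ → ℕ
height T       zero          = 0
height []      (suc a)       = 0
height (h ∷ T) (suc zero)    = h
height (h ∷ T) (suc (suc a)) = height T (suc a)

_≈ᵀ_ : Diagram → Diagram → Set
T ≈ᵀ U = (a : ℕ) → height T a ≡ height U a

-- cells (a , b) : south-east corner of [a-1,a] × [b,b+1]
Cell : Set
Cell = ℕ × ℕ

_∈ᵀ_ : Cell → Diagram → Set
(a , b) ∈ᵀ T = b < height T a

sl : Cell → ℕ
sl (a , b) = a + b

IsTopCell : Diagram → Cell → Set
IsTopCell T (a , b) = (1 ≤ a) × (0 < height T a) × (b ≡ height T a ∸ 1)

removeTop : Diagram → ℕ → Diagram
removeTop T       zero          = T
removeTop []      (suc a)       = []
removeTop (h ∷ T) (suc zero)    = (h ∸ 1) ∷ T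
removeTop (h ∷ T) (suc (suc a)) = h ∷ removeTop T (suc a)

_-ᶜ_ : Diagram → Cell → Diagram
T -ᶜ (a , b) = removeTop T a

-- Sliding.
-- slideAux s p T' : current value s, examining tower p, where T' is the
-- list of towers T_p, T_{p+1}, … (heights beyond the list are 0).

slideAux : ℕ → ℕ → List ℕ → List ℕ
-- Beyond the list all towers have height 0: towers p, …, s-1 are passed
-- (s > p + 0) and tower s is increased to 1.  (The invariant s ≥ p always
-- holds when sliding from p = 1 with s = i ≥ 1, so the case s < p never
-- occurs.)
slideAux s p [] = replicate (s ∸ p) 0 ∷ʳ 1
slideAux s p (h ∷ T) with <-cmp (p + h) s
... | tri< _ _ _ = h ∷ slideAux s (suc p) T
... | tri≈ _ _ _ = suc h ∷ T
... | tri> _ _ _ with h | s ≟ (p + h ∸ 1)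
...   | suc h' | yes _ = h' ∷ T
...   | h₀     | _     = h₀ ∷ slideAux (suc s) (suc p) T

slide : Diagram → ℕ → Diagram
slide T i = slideAux i 1 T

slideWord : Diagram → List ℕ → Diagram
slideWord T []       = T
slideWord T (x ∷ xs) = slideWord (slide T x) xs

down : ℕ → ℕ → List ℕ
down i zero    = []
down i (suc k) = (i + suc k) ∷ down i k

up : ℕ → ℕ → List ℕ
up i zero    = []
up i (suc k) = up i k ∷ʳ (i + suc k)

hookWord : ℕ → ℕ → List ℕ
hookWord i j = down i (j ∸ i) ++ (i ∷ up i (j ∸ i))

hookSlide : ℕ → ℕ → Diagram → Diagram
hookSlide i j D = slideWord D (hookWord i j)

flightPath : Diagram → ℕ → ℕ → List Cell
flightPath T zero b = []          -- (0 , b) is not a cell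
flightPath T (suc zero) b = (1 , b) ∷ []
flightPath T (suc (suc a)) b =
  flightPath T (suc a) (if b <ᵇ height T (suc a) then b else suc b)
    ∷ʳ (suc (suc a) , b)

fp : Diagram → Cell → List Cell
fp T (a , b) = flightPath T a b

firstCell : List Cell → Cell
firstCell []      = (0 , 0)   -- never used: flight paths of cells are nonempty
firstCell (c ∷ _) = c

dropLast : {A : Set} → List A → List A
dropLast []           = []
dropLast (x ∷ [])     = []
dropLast (x ∷ y ∷ xs) = x ∷ dropLast (y ∷ xs)

fn : Diagram → Cell → ℕ
fn T c = sl (firstCell (fp T c))

-- one step n_q ↦ n_{q-1} with the cell c_{q-1} = (a , b)
hookStep : Diagram → Cell → ℕ → ℕ
hookStep T (a , b) n with b <? height T a
... | no  _ = n
... | yes _ with n <? (height T a ∸ suc b)   -- h = cells strictly above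
...   | yes _ = n
...   | no  _ = suc n

-- n₁, computed from n_p = 0 through c_{p-1}, …, c_1
hookN : Diagram → Cell → ℕ
hookN T c = foldr (hookStep T) 0 (dropLast (fp T c))

hn : Diagram → Cell → ℕ
hn T c = hookN T c + sl (firstCell (fp T c))

gfn : Diagram → Cell → ℕ × ℕ
gfn T c = fn T c , hn T c

-- Permutations of the positive integers (as functions ℕ → ℕ; 0 is fixed
-- by all permutations considered), composed as functions.

transp : ℕ → ℕ → ℕ → ℕ
transp a b x with x ≟ a
... | yes _ = b
... | no  _ with x ≟ b
...   | yes _ = a
...   | no  _ = x

sgen : ℕ → ℕ → ℕ
sgen p = transp p (suc p)

wordPerm : List ℕ → ℕ → ℕ
wordPerm []       x = x
wordPerm (α ∷ αs) x = sgen α (wordPerm αs x)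

_≗ₚ_ : (ℕ → ℕ) → (ℕ → ℕ) → Set
f ≗ₚ g = (x : ℕ) → f x ≡ g x

IsReducedWord : List ℕ → (ℕ → ℕ) → Set
IsReducedWord α ω =
  All (1 ≤_) α × (wordPerm α ≗ₚ ω) ×
  ((β : List ℕ) → All (1 ≤_) β → wordPerm β ≗ₚ ω → length α ≤ length β)

TowerOfPerm : (ℕ → ℕ) → Diagram → Set
TowerOfPerm ω D = (α : List ℕ) → IsReducedWord α ω → slideWord [] α ≈ᵀ D

module Submission where

-- Read a tower diagram D as a permutation: decode D sends 1 to
-- D₁ + 1 and places the values decoded from the towers D₂, D₃, … into the
-- remaining positions in increasing order (this is the inverse of the
-- permutation ω with 𝒯_ω = D).  Three facts about this encoding carry the proof.
--  (1) Sliding a letter p ≥ 1 into D multiplies decode D on the left by s_p,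
--      so sliding a word w gives (s_{w_l} ⋯ s_{w_1}) ∘ decode D.
--  (2) decode D determines D up to ≈ᵀ.  Together with (1) and a count of cells
--      this shows that every positive word can be shortened to a reduced word
--      of the same permutation, and that for a permutation ω spelled by a
--      positive word, 𝒯_ω = D iff ω ∘ decode D = id.
--  (3) Removing a top cell c multiplies decode by a transposition:
--      decode T = t_{i,j+1} ∘ decode (T - c) with (i , j) = gfn(T , c); the
--      flight path and the hook recursion compute exactly where the removed
--      value travels when it is pushed through the columns to the left of c.
-- The hook word of (i , j) spells t_{i,j+1}, so by (1) and (3) sliding it into
-- T - c has the decoding of T, and (2) gives both parts of the theorem.

open import Defs
open import Data.Nat using (ℕ; zero; suc; _+_; _∸_; _≤_; _<_; _<ᵇ_; _<?_; _≟_; z≤n; s≤s)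
open import Data.Nat.Properties
open import Data.Nat.ListAction using (sum)
open import Data.Product using (_×_; _,_; Σ)
open import Data.List using (List; []; _∷_; _∷ʳ_; _++_; replicate; length; foldr)
open import Data.List.Properties using (foldr-∷ʳ; ++-assoc; length-++)
open import Data.List.Relation.Unary.All using (All; []; _∷_)
open import Data.List.Relation.Unary.All.Properties using (++⁺)
open import Relation.Binary using (tri<; tri≈; tri>)
open import Relation.Binary.PropositionalEquality
open import Relation.Nullary using (yes; no)
open import Data.Empty using (⊥-elim)
open import Data.Bool using (true; false; if_then_else_) renaming (T to IsTrue)
open import Function.Definitions using (Injective)

transp-left : ∀ a b → transp a b a ≡ b
transp-left a b with a ≟ a
... | yes _  = refl
... | no a≢a = ⊥-elim (a≢a refl)

transp-right : ∀ a b → transp a b b ≡ a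
transp-right a b with b ≟ a
... | yes b≡a = b≡a
... | no _ with b ≟ b
...   | yes _  = refl
...   | no b≢b = ⊥-elim (b≢b refl)

transp-other : ∀ a b x → x ≢ a → x ≢ b → transp a b x ≡ x
transp-other a b x x≢a x≢b with x ≟ a
... | yes x≡a = ⊥-elim (x≢a x≡a)
... | no _ with x ≟ b
...   | yes x≡b = ⊥-elim (x≢b x≡b)
...   | no _    = refl

data TranspCase (a b x : ℕ) : Set where
  at-left  : x ≡ a → TranspCase a b x
  at-right : x ≢ a → x ≡ b → TranspCase a b x
  elsewhere : x ≢ a → x ≢ b → TranspCase a b x

transpCase : ∀ a b x → TranspCase a b x
transpCase a b x with x ≟ a
... | yes x≡a = at-left x≡a
... | no x≢a with x ≟ b
...   | yes x≡b = at-right x≢a x≡b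
...   | no x≢b  = elsewhere x≢a x≢b

transp-involutive : ∀ a b x → transp a b (transp a b x) ≡ x
transp-involutive a b x with transpCase a b x
... | at-left refl      = trans (cong (transp x b) (transp-left x b)) (transp-right x b)
... | at-right _ refl   = trans (cong (transp a x) (transp-right a x)) (transp-left a x)
... | elsewhere x≢a x≢b =
  trans (cong (transp a b) (transp-other a b x x≢a x≢b)) (transp-other a b x x≢a x≢b)

transp-natural : (f : ℕ → ℕ) → Injective _≡_ _≡_ f →
  ∀ a b x → f (transp a b x) ≡ transp (f a) (f b) (f x)
transp-natural f f-inj a b x with transpCase a b x
... | at-left refl      = trans (cong f (transp-left x b)) (sym (transp-left (f x) (f b)))
... | at-right _ refl   = trans (cong f (transp-right a x)) (sym (transp-right (f a) (f x)))
... | elsewhere x≢a x≢b = trans (cong f (transp-other a b x x≢a x≢b))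
  (sym (transp-other (f a) (f b) (f x) (λ e → x≢a (f-inj e)) (λ e → x≢b (f-inj e))))

-- skip h fixes 0 and maps the positive integers increasingly onto ℕ ∖ {0 , h+1}.
skip : ℕ → ℕ → ℕ
skip h       zero    = zero
skip zero    (suc v) = suc (suc v)
skip (suc h) (suc v) = suc (skip h v)

skip-below : ∀ h v → v ≤ h → skip h v ≡ v
skip-below h       zero    _         = refl
skip-below (suc h) (suc v) (s≤s v≤h) = cong suc (skip-below h v v≤h)

skip-above : ∀ h v → h < v → skip h v ≡ suc v
skip-above zero    (suc v) _         = refl
skip-above (suc h) (suc v) (s≤s h<v) = cong suc (skip-above h v h<v)

skip-injective : ∀ h → Injective _≡_ _≡_ (skip h)
skip-injective h       {zero}  {zero}  _ = refl
skip-injective zero    {zero}  {suc v} ()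
skip-injective (suc h) {zero}  {suc v} ()
skip-injective zero    {suc u} {zero}  ()
skip-injective (suc h) {suc u} {zero}  ()
skip-injective zero    {suc u} {suc v} e = suc-injective e
skip-injective (suc h) {suc u} {suc v} e = cong suc (skip-injective h (suc-injective e))

skip-avoids : ∀ h v → skip h v ≢ suc h
skip-avoids h       zero    ()
skip-avoids zero    (suc v) ()
skip-avoids (suc h) (suc v) e = skip-avoids h v (suc-injective e)

skip-nonzero : ∀ h v → v ≢ 0 → skip h v ≢ 0
skip-nonzero h       zero    v≢0 = ⊥-elim (v≢0 refl)
skip-nonzero zero    (suc v) _   = λ ()
skip-nonzero (suc h) (suc v) _   = λ ()

sgen-skip : ∀ h v → sgen (suc h) (skip h v) ≡ skip (suc h) v
sgen-skip h       zero          = transp-other (suc h) (suc (suc h)) 0 (λ ()) (λ ())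
sgen-skip zero    (suc zero)    = transp-right 1 2
sgen-skip zero    (suc (suc w)) = transp-other 1 2 (suc (suc (suc w))) (λ ()) (λ ())
sgen-skip (suc h) (suc v) =
  trans (sym (transp-natural suc suc-injective (suc h) (suc (suc h)) (skip h v)))
        (cong suc (sgen-skip h v))

decode : Diagram → ℕ → ℕ
decode []      x             = x
decode (h ∷ D) zero          = zero
decode (h ∷ D) (suc zero)    = suc h
decode (h ∷ D) (suc (suc x)) = skip h (decode D (suc x))

decode-zero : ∀ D → decode D zero ≡ zero
decode-zero []      = refl
decode-zero (h ∷ D) = refl

decode-zero-cons : ∀ E → (∀ x → decode E x ≡ x) → ∀ x → decode (0 ∷ E) x ≡ x
decode-zero-cons E id-E zero          = refl
decode-zero-cons E id-E (suc zero)    = refl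
decode-zero-cons E id-E (suc (suc y)) = cong (skip 0) (id-E (suc y))

decode-cons : ∀ h {T T'} u v → u ≢ 0 → v ≢ 0 →
  (∀ y → decode T' (suc y) ≡ transp u v (decode T (suc y))) →
  ∀ x → decode (h ∷ T') x ≡ transp (skip h u) (skip h v) (decode (h ∷ T) x)
decode-cons h u v u≢0 v≢0 step zero =
  sym (transp-other (skip h u) (skip h v) 0
         (λ e → skip-nonzero h u u≢0 (sym e)) (λ e → skip-nonzero h v v≢0 (sym e)))
decode-cons h u v u≢0 v≢0 step (suc zero) =
  sym (transp-other (skip h u) (skip h v) (suc h)
         (λ e → skip-avoids h u (sym e)) (λ e → skip-avoids h v (sym e)))
decode-cons h {T} u v u≢0 v≢0 step (suc (suc y)) =
  trans (cong (skip h) (step y)) (transp-natural (skip h) (skip-injective h) u v (decode T (suc y)))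

decode-grow : ∀ h T x → decode (suc h ∷ T) x ≡ sgen (suc h) (decode (h ∷ T) x)
decode-grow h T zero          = sym (transp-other (suc h) (suc (suc h)) 0 (λ ()) (λ ()))
decode-grow h T (suc zero)    = sym (transp-left (suc h) (suc (suc h)))
decode-grow h T (suc (suc y)) = sym (sgen-skip h (decode T (suc y)))

decode-shrink : ∀ h T x → decode (h ∷ T) x ≡ sgen (suc h) (decode (suc h ∷ T) x)
decode-shrink h T x =
  trans (sym (transp-involutive _ _ _)) (cong (sgen (suc h)) (sym (decode-grow h T x)))

-- The diagram created when a slide runs past the end of the list.
decode-new-tower : ∀ k x → decode (replicate k 0 ∷ʳ 1) x ≡ sgen (suc k) x
decode-new-tower zero    x = trans (decode-grow 0 [] x) (cong (sgen 1) (decode-zero-cons [] (λ _ → refl) x))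
decode-new-tower (suc k) x =
  trans (decode-cons 0 {[]} (suc k) (suc (suc k)) (λ ()) (λ ()) (λ y → decode-new-tower k (suc y)) x)
        (cong (sgen (suc (suc k))) (decode-zero-cons [] (λ _ → refl) x))

-- (1) Sliding acts by left multiplication.

slideAux-decode : ∀ T q k x → decode (slideAux (q + k) q T) x ≡ sgen (suc k) (decode T x)
slideAux-decode [] q k x rewrite m+n∸m≡n q k = decode-new-tower k x
slideAux-decode (h ∷ T) q k x with <-cmp (q + h) (q + k)
slideAux-decode (h ∷ T) q zero x    | tri< lt _ _ =
  ⊥-elim (<-irrefl refl (≤-trans (+-cancelˡ-< q h zero lt) z≤n))
slideAux-decode (h ∷ T) q (suc k) x | tri< lt _ _ with +-cancelˡ-< q h (suc k) lt
... | h<k+1 rewrite +-suc q k =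
  trans (decode-cons h (suc k) (suc (suc k)) (λ ()) (λ ()) (λ y → slideAux-decode T (suc q) k (suc y)) x)
        (cong₂ (λ u v → transp u v (decode (h ∷ T) x))
               (skip-above h (suc k) h<k+1) (skip-above h (suc (suc k)) (m<n⇒m<1+n h<k+1)))
slideAux-decode (h ∷ T) q k x | tri≈ _ e _ rewrite +-cancelˡ-≡ q h k e = decode-grow k T x
slideAux-decode (zero ∷ T) q k x  | tri> _ _ gt =
  ⊥-elim (<-irrefl refl (≤-trans (+-cancelˡ-< q k zero gt) z≤n))
slideAux-decode (suc h ∷ T) q k x | tri> _ _ gt with (q + k) ≟ (q + suc h ∸ 1)
... | yes e rewrite +-cancelˡ-≡ q k h (trans e (cong (_∸ 1) (+-suc q h))) = decode-shrink h T x
... | no ne =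
  trans (decode-cons (suc h) (suc k) (suc (suc k)) (λ ()) (λ ()) (λ y → slideAux-decode T (suc q) k (suc y)) x)
        (cong₂ (λ u v → transp u v (decode (suc h ∷ T) x))
               (skip-below (suc h) (suc k) (≤-trans (n≤1+n _) k+2≤h+1))
               (skip-below (suc h) (suc (suc k)) k+2≤h+1))
  where
  k+2≤h+1 : suc (suc k) ≤ suc h
  k+2≤h+1 = s≤s (≤∧≢⇒< (≤-pred (+-cancelˡ-< q k (suc h) gt))
                        (λ e → ne (trans (cong (q +_) e) (sym (cong (_∸ 1) (+-suc q h))))))

slide-decode : ∀ D p x → decode (slide D (suc p)) x ≡ sgen (suc p) (decode D x)
slide-decode D p = slideAux-decode D 1 p

Positive : List ℕ → Set
Positive = All (1 ≤_)

wordPerm⁻¹ : List ℕ → ℕ → ℕ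
wordPerm⁻¹ []       v = v
wordPerm⁻¹ (a ∷ as) v = wordPerm⁻¹ as (sgen a v)

slideWord-decode : ∀ w → Positive w → ∀ D x → decode (slideWord D w) x ≡ wordPerm⁻¹ w (decode D x)
slideWord-decode []           _           D x = refl
slideWord-decode (zero ∷ as)  (() ∷ _)
slideWord-decode (suc a ∷ as) (_ ∷ as-pos) D x =
  trans (slideWord-decode as as-pos (slide D (suc a)) x) (cong (wordPerm⁻¹ as) (slide-decode D a x))

wordPerm-wordPerm⁻¹ : ∀ w v → wordPerm w (wordPerm⁻¹ w v) ≡ v
wordPerm-wordPerm⁻¹ []       v = refl
wordPerm-wordPerm⁻¹ (a ∷ as) v =
  trans (cong (sgen a) (wordPerm-wordPerm⁻¹ as (sgen a v))) (transp-involutive a (suc a) v)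

wordPerm⁻¹-wordPerm : ∀ w v → wordPerm⁻¹ w (wordPerm w v) ≡ v
wordPerm⁻¹-wordPerm []       v = refl
wordPerm⁻¹-wordPerm (a ∷ as) v =
  trans (cong (wordPerm⁻¹ as) (transp-involutive a (suc a) (wordPerm as v))) (wordPerm⁻¹-wordPerm as v)

wordPerm⁻¹-cong : ∀ u w → wordPerm u ≗ₚ wordPerm w → wordPerm⁻¹ u ≗ₚ wordPerm⁻¹ w
wordPerm⁻¹-cong u w same v =
  trans (cong (wordPerm⁻¹ u) (sym (trans (same (wordPerm⁻¹ w v)) (wordPerm-wordPerm⁻¹ w v))))
        (wordPerm⁻¹-wordPerm u (wordPerm⁻¹ w v))

wordPerm-++ : ∀ xs ys x → wordPerm (xs ++ ys) x ≡ wordPerm xs (wordPerm ys x)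
wordPerm-++ []       ys x = refl
wordPerm-++ (a ∷ as) ys x = cong (sgen a) (wordPerm-++ as ys x)

slideWord-++ : ∀ D xs ys → slideWord D (xs ++ ys) ≡ slideWord (slideWord D xs) ys
slideWord-++ D []       ys = refl
slideWord-++ D (a ∷ as) ys = slideWord-++ (slide D a) as ys

-- (2) The decoding determines the diagram.

height-zero : ∀ T → height T zero ≡ 0
height-zero []      = refl
height-zero (h ∷ T) = refl

≈ᵀ-sym : ∀ {D E} → D ≈ᵀ E → E ≈ᵀ D
≈ᵀ-sym D≈E a = sym (D≈E a)

≈ᵀ-tail : ∀ {h D h' E} → (h ∷ D) ≈ᵀ (h' ∷ E) → D ≈ᵀ E
≈ᵀ-tail {D = D} {E = E} _ zero = trans (height-zero D) (sym (height-zero E))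
≈ᵀ-tail eq (suc a) = eq (suc (suc a))

≈ᵀ-cons : ∀ {h D h' E} → h ≡ h' → D ≈ᵀ E → (h ∷ D) ≈ᵀ (h' ∷ E)
≈ᵀ-cons _    _   zero          = refl
≈ᵀ-cons h≡h' _   (suc zero)    = h≡h'
≈ᵀ-cons _    D≈E (suc (suc a)) = D≈E (suc a)

empty≈-tail : ∀ {h E} → [] ≈ᵀ (h ∷ E) → [] ≈ᵀ E
empty≈-tail {E = E} _ zero = sym (height-zero E)
empty≈-tail eq (suc a) = eq (suc (suc a))

empty≈-zero-cons : ∀ {E} → [] ≈ᵀ E → [] ≈ᵀ (0 ∷ E)
empty≈-zero-cons _  zero          = refl
empty≈-zero-cons _  (suc zero)    = refl
empty≈-zero-cons eq (suc (suc a)) = eq (suc a)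

decode-identity : ∀ D → (∀ x → decode D x ≡ x) → [] ≈ᵀ D
decode-identity []      _    a = refl
decode-identity (h ∷ D) id-D with suc-injective (id-D 1)
... | refl = empty≈-zero-cons (decode-identity D id-tail)
  where
  id-tail : ∀ x → decode D x ≡ x
  id-tail zero    = decode-zero D
  id-tail (suc y) = skip-injective 0 (id-D (suc (suc y)))

decode-injective : ∀ D E → (∀ x → decode D x ≡ decode E x) → D ≈ᵀ E
decode-injective []      E       same = decode-identity E (λ x → sym (same x))
decode-injective (h ∷ D) []      same = ≈ᵀ-sym (decode-identity (h ∷ D) same)
decode-injective (h ∷ D) (h' ∷ E) same with suc-injective (same 1)
... | refl = ≈ᵀ-cons refl (decode-injective D E same-tail)
  where
  same-tail : ∀ x → decode D x ≡ decode E x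
  same-tail zero    = trans (decode-zero D) (sym (decode-zero E))
  same-tail (suc y) = skip-injective h (same (suc (suc y)))

decode-cong : ∀ D E → D ≈ᵀ E → ∀ x → decode D x ≡ decode E x
decode-cong []      []       _   x = refl
decode-cong []      (h ∷ E)  eq  x with eq 1
... | refl = sym (decode-zero-cons E (λ y → sym (decode-cong [] E (empty≈-tail eq) y)) x)
decode-cong (h ∷ D) []       eq  x with eq 1
... | refl = decode-zero-cons D (λ y → decode-cong D [] (≈ᵀ-sym (empty≈-tail (≈ᵀ-sym eq))) y) x
decode-cong (h ∷ D) (h' ∷ E) eq  x with eq 1
... | refl = same x
  where
  same : ∀ x → decode (h ∷ D) x ≡ decode (h ∷ E) x
  same zero          = refl
  same (suc zero)    = refl
  same (suc (suc y)) = cong (skip h) (decode-cong D E (≈ᵀ-tail eq) (suc y))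

size : Diagram → ℕ
size = sum

size-cong : ∀ D E → D ≈ᵀ E → size D ≡ size E
size-cong []      []       _  = refl
size-cong []      (h ∷ E)  eq with eq 1
... | refl = size-cong [] E (empty≈-tail eq)
size-cong (h ∷ D) []       eq with eq 1
... | refl = size-cong D [] (≈ᵀ-sym (empty≈-tail (≈ᵀ-sym eq)))
size-cong (h ∷ D) (h' ∷ E) eq = cong₂ _+_ (eq 1) (size-cong D E (≈ᵀ-tail eq))

size-new-tower : ∀ k → size (replicate k 0 ∷ʳ 1) ≡ 1
size-new-tower zero    = refl
size-new-tower (suc k) = size-new-tower k

-- A slide adds or removes exactly one cell; we only need the upper bound.
slideAux-size : ∀ s q T → size (slideAux s q T) ≤ suc (size T)
slideAux-size s q [] = ≤-reflexive (size-new-tower (s ∸ q))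
slideAux-size s q (h ∷ T) with <-cmp (q + h) s
... | tri< _ _ _ = ≤-trans (+-monoʳ-≤ h (slideAux-size s (suc q) T)) (≤-reflexive (+-suc h (size T)))
... | tri≈ _ _ _ = ≤-refl
slideAux-size s q (zero ∷ T)  | tri> _ _ _ = slideAux-size (suc s) (suc q) T
slideAux-size s q (suc h ∷ T) | tri> _ _ _ with s ≟ (q + suc h ∸ 1)
... | yes _ = ≤-trans (n≤1+n _) (n≤1+n _)
... | no _  = s≤s (≤-trans (+-monoʳ-≤ h (slideAux-size (suc s) (suc q) T)) (≤-reflexive (+-suc h (size T))))

slideWord-size : ∀ D w → size (slideWord D w) ≤ size D + length w
slideWord-size D []       = ≤-reflexive (sym (+-identityʳ _))
slideWord-size D (a ∷ as) =
  ≤-trans (slideWord-size (slide D a) as)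
    (≤-trans (+-monoˡ-≤ (length as) (slideAux-size a 1 D)) (≤-reflexive (sym (+-suc (size D) (length as)))))

-- Every nonempty diagram has a letter whose slide removes a cell: the value
-- q + h slid into a first nonzero tower of height h+1 decreases it.
slideAux-descent : ∀ T q m → size T ≡ suc m → Σ ℕ λ k → size (slideAux (q + k) q T) ≡ m
slideAux-descent []          q m ()
slideAux-descent (suc h ∷ T) q m e = h , trans shrink (suc-injective e)
  where
  shrink : size (slideAux (q + h) q (suc h ∷ T)) ≡ h + size T
  shrink with <-cmp (q + suc h) (q + h)
  ... | tri< a _ _ = ⊥-elim (<-asym a (+-monoʳ-< q (n<1+n h)))
  ... | tri≈ _ b _ = ⊥-elim (<⇒≢ (+-monoʳ-< q (n<1+n h)) (sym b))
  ... | tri> _ _ _ with (q + h) ≟ (q + suc h ∸ 1)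
  ...   | yes _ = refl
  ...   | no ne = ⊥-elim (ne (sym (cong (_∸ 1) (+-suc q h))))
slideAux-descent (zero ∷ T) q m e with slideAux-descent T (suc q) m e
... | k , e' = suc k , pass
  where
  pass : size (slideAux (q + suc k) q (zero ∷ T)) ≡ m
  pass rewrite +-suc q k with <-cmp (q + zero) (suc (q + k))
  ... | tri< _ _ _ = e'
  ... | tri≈ _ b _ = ⊥-elim (<⇒≢ (s≤s (+-monoʳ-≤ q (z≤n {k}))) b)
  ... | tri> _ _ c = ⊥-elim (<-asym (s≤s (+-monoʳ-≤ q (z≤n {k}))) c)

size-zero-decode : ∀ D → size D ≡ 0 → ∀ x → decode D x ≡ x
size-zero-decode []      _ x = refl
size-zero-decode (h ∷ D) e with m+n≡0⇒m≡0 h e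
... | refl = decode-zero-cons D (size-zero-decode D e)

-- A positive word α spells the same permutation as a positive word of length
-- |𝒯_α|: repeatedly append the letter that removes a cell from 𝒯_α.
shortWord : ∀ n α → Positive α → size (slideWord [] α) ≡ n →
  Σ (List ℕ) λ γ → Positive γ × (wordPerm γ ≗ₚ wordPerm α) × (length γ ≡ n)
shortWord zero α α-pos e = [] , [] , id≗α , refl
  where
  α⁻¹-id : ∀ x → wordPerm⁻¹ α x ≡ x
  α⁻¹-id x = trans (sym (slideWord-decode α α-pos [] x)) (size-zero-decode (slideWord [] α) e x)
  id≗α : ∀ x → x ≡ wordPerm α x
  id≗α x = sym (trans (cong (wordPerm α) (sym (α⁻¹-id x))) (wordPerm-wordPerm⁻¹ α x))
shortWord (suc m) α α-pos e with slideAux-descent (slideWord [] α) 1 m e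
... | k , smaller with shortWord m (α ++ (suc k ∷ [])) (++⁺ α-pos (s≤s z≤n ∷ []))
                       (trans (cong size (slideWord-++ [] α (suc k ∷ []))) smaller)
... | γ , γ-pos , γ≗αs , len =
  γ ++ (suc k ∷ []) , ++⁺ γ-pos (s≤s z≤n ∷ []) , γs≗α ,
  trans (length-++ γ) (trans (cong (_+ 1) len) (+-comm m 1))
  where
  γs≗α : wordPerm (γ ++ (suc k ∷ [])) ≗ₚ wordPerm α
  γs≗α x = begin
      wordPerm (γ ++ (suc k ∷ [])) x
    ≡⟨ wordPerm-++ γ _ x ⟩
      wordPerm γ (sgen (suc k) x)
    ≡⟨ γ≗αs _ ⟩
      wordPerm (α ++ (suc k ∷ [])) (sgen (suc k) x)
    ≡⟨ wordPerm-++ α _ _ ⟩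
      wordPerm α (sgen (suc k) (sgen (suc k) x))
    ≡⟨ cong (wordPerm α) (transp-involutive _ _ x) ⟩
      wordPerm α x
    ∎ where open ≡-Reasoning

-- Every permutation spelled by a positive word has a reduced word; it has
-- length |𝒯_α|, which bounds the length of every positive word for it.
reducedWord-exists : ∀ α → Positive α → Σ (List ℕ) λ γ → IsReducedWord γ (wordPerm α)
reducedWord-exists α α-pos with shortWord _ α α-pos refl
... | γ , γ-pos , γ≗α , len = γ , γ-pos , γ≗α , minimal
  where
  minimal : (δ : List ℕ) → Positive δ → wordPerm δ ≗ₚ wordPerm α → length γ ≤ length δ
  minimal δ δ-pos δ≗α = ≤-trans (≤-reflexive (trans len (size-cong _ _ same-diagram))) (slideWord-size [] δ)
    where
    same-diagram : slideWord [] α ≈ᵀ slideWord [] δ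
    same-diagram = decode-injective _ _ λ x →
      trans (slideWord-decode α α-pos [] x)
            (trans (wordPerm⁻¹-cong α δ (λ y → sym (δ≗α y)) x) (sym (slideWord-decode δ δ-pos [] x)))

inverse⇒towerOfPerm : ∀ ω D → (∀ x → ω (decode D x) ≡ x) → TowerOfPerm ω D
inverse⇒towerOfPerm ω D ω∘D β (β-pos , β≗ω , _) = decode-injective _ D λ x →
  begin
    decode (slideWord [] β) x       ≡⟨ slideWord-decode β β-pos [] x ⟩
    wordPerm⁻¹ β x                  ≡⟨ cong (wordPerm⁻¹ β) (sym (ω∘D x)) ⟩
    wordPerm⁻¹ β (ω (decode D x))    ≡⟨ cong (wordPerm⁻¹ β) (sym (β≗ω _)) ⟩
    wordPerm⁻¹ β (wordPerm β (decode D x)) ≡⟨ wordPerm⁻¹-wordPerm β _ ⟩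
    decode D x
  ∎ where open ≡-Reasoning

towerOfPerm⇒inverse : ∀ ω D α → Positive α → wordPerm α ≗ₚ ω →
  TowerOfPerm ω D → ∀ x → ω (decode D x) ≡ x
towerOfPerm⇒inverse ω D α α-pos α≗ω tower x with reducedWord-exists α α-pos
... | γ , γ-pos , γ≗α , γ-min = begin
    ω (decode D x)                          ≡⟨ cong ω (sym (decode-cong _ D 𝒯γ≈D x)) ⟩
    ω (decode (slideWord [] γ) x)           ≡⟨ cong ω (slideWord-decode γ γ-pos [] x) ⟩
    ω (wordPerm⁻¹ γ x)                      ≡⟨ sym (γ≗ω _) ⟩
    wordPerm γ (wordPerm⁻¹ γ x)             ≡⟨ wordPerm-wordPerm⁻¹ γ x ⟩
    x
  ∎
  where
  open ≡-Reasoning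
  γ≗ω : wordPerm γ ≗ₚ ω
  γ≗ω y = trans (γ≗α y) (α≗ω y)
  𝒯γ≈D : slideWord [] γ ≈ᵀ D
  𝒯γ≈D = tower γ (γ-pos , γ≗ω , λ δ δ-pos δ≗ω → γ-min δ δ-pos (λ y → trans (δ≗ω y) (sym (α≗ω y))))

sgen-conj : ∀ i M x → i < M → sgen M (transp i M (sgen M x)) ≡ transp i (suc M) x
sgen-conj i M x i<M = begin
    sgen M (transp i M (sgen M x))
  ≡⟨ transp-natural (sgen M) sM-injective i M (sgen M x) ⟩
    transp (sgen M i) (sgen M M) (sgen M (sgen M x))
  ≡⟨ cong₂ (λ u w → transp u w (sgen M (sgen M x)))
       (transp-other M (suc M) i (<⇒≢ i<M) (<⇒≢ (m<n⇒m<1+n i<M))) (transp-left M (suc M)) ⟩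
    transp i (suc M) (sgen M (sgen M x))
  ≡⟨ cong (transp i (suc M)) (transp-involutive M (suc M) x) ⟩
    transp i (suc M) x
  ∎
  where
  open ≡-Reasoning
  sM-injective : Injective _≡_ _≡_ (sgen M)
  sM-injective {u} {v} e =
    trans (sym (transp-involutive M (suc M) u)) (trans (cong (sgen M) e) (transp-involutive M (suc M) v))

hookWord-perm′ : ∀ i k x → wordPerm (down i k ++ (i ∷ up i k)) x ≡ transp i (suc (i + k)) x
hookWord-perm′ i zero    x rewrite +-identityʳ i = refl
hookWord-perm′ i (suc k) x = begin
    sgen m (wordPerm (down i k ++ (i ∷ (up i k ∷ʳ m))) x)
  ≡⟨ cong (λ w → sgen m (wordPerm w x)) (sym (++-assoc (down i k) (i ∷ up i k) (m ∷ []))) ⟩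
    sgen m (wordPerm ((down i k ++ (i ∷ up i k)) ++ (m ∷ [])) x)
  ≡⟨ cong (sgen m) (wordPerm-++ (down i k ++ (i ∷ up i k)) (m ∷ []) x) ⟩
    sgen m (wordPerm (down i k ++ (i ∷ up i k)) (sgen m x))
  ≡⟨ cong (sgen m) (hookWord-perm′ i k (sgen m x)) ⟩
    sgen m (transp i (suc (i + k)) (sgen m x))
  ≡⟨ subst (λ z → sgen z (transp i (suc (i + k)) (sgen z x)) ≡ transp i (suc z) x)
       (sym (+-suc i k)) (sgen-conj i (suc (i + k)) x (s≤s (m≤m+n i k))) ⟩
    transp i (suc m) x
  ∎
  where
  open ≡-Reasoning
  m = i + suc k

hookWord-perm : ∀ i j → i ≤ j → wordPerm (hookWord i j) ≗ₚ transp i (suc j)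
hookWord-perm i j i≤j x =
  trans (hookWord-perm′ i (j ∸ i) x) (cong (λ z → transp i (suc z) x) (m+[n∸m]≡n i≤j))

hookWord-positive : ∀ i j → 1 ≤ i → Positive (hookWord i j)
hookWord-positive i j 1≤i = ++⁺ (down-pos (j ∸ i)) (1≤i ∷ up-pos (j ∸ i))
  where
  down-pos : ∀ k → Positive (down i k)
  down-pos zero    = []
  down-pos (suc k) = ≤-trans 1≤i (m≤m+n i (suc k)) ∷ down-pos k
  up-pos : ∀ k → Positive (up i k)
  up-pos zero    = []
  up-pos (suc k) = ++⁺ (up-pos k) (≤-trans 1≤i (m≤m+n i (suc k)) ∷ [])

hookSlide-decode : ∀ i j D → 1 ≤ i → i ≤ j → ∀ x →
  decode (hookSlide i j D) x ≡ transp i (suc j) (decode D x)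
hookSlide-decode i j D 1≤i i≤j x = begin
    decode (hookSlide i j D) x                ≡⟨ slideWord-decode hw (hookWord-positive i j 1≤i) D x ⟩
    wordPerm⁻¹ hw v                           ≡⟨ cong (wordPerm⁻¹ hw) (sym (transp-involutive i (suc j) v)) ⟩
    wordPerm⁻¹ hw (transp i (suc j) (transp i (suc j) v))
                                              ≡⟨ cong (wordPerm⁻¹ hw) (sym (hookWord-perm i j i≤j _)) ⟩
    wordPerm⁻¹ hw (wordPerm hw (transp i (suc j) v)) ≡⟨ wordPerm⁻¹-wordPerm hw _ ⟩
    transp i (suc j) v
  ∎
  where
  open ≡-Reasoning
  hw = hookWord i j
  v  = decode D x

-- (3) Removing a top cell.

-- lift T a v : the value v attached to column a, pushed leftwards through the
-- columns a-1, …, 1 (each column h shifts it by skip h).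
lift : Diagram → ℕ → ℕ → ℕ
lift T       zero          v = v
lift T       (suc zero)    v = v
lift []      (suc (suc a)) v = skip 0 (lift [] (suc a) v)
lift (h ∷ T) (suc (suc a)) v = skip h (lift T (suc a) v)

lift-step : ∀ T a v → lift T (suc (suc a)) v ≡ lift T (suc a) (skip (height T (suc a)) v)
lift-step []      zero    v = refl
lift-step (h ∷ T) zero    v = refl
lift-step []      (suc a) v = cong (skip 0) (lift-step [] a v)
lift-step (h ∷ T) (suc a) v = cong (skip h) (lift-step T a v)

lift-nonzero : ∀ T a u → u ≢ 0 → lift T a u ≢ 0
lift-nonzero T       zero          u u≢0 = u≢0
lift-nonzero T       (suc zero)    u u≢0 = u≢0
lift-nonzero []      (suc (suc a)) u u≢0 = skip-nonzero 0 _ (lift-nonzero [] (suc a) u u≢0)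
lift-nonzero (h ∷ T) (suc (suc a)) u u≢0 = skip-nonzero h _ (lift-nonzero T (suc a) u u≢0)

decode-removeTop : ∀ T a → 0 < height T (suc a) → ∀ x →
  decode T x ≡ transp (lift T (suc a) (height T (suc a))) (lift T (suc a) (suc (height T (suc a))))
                      (decode (removeTop T (suc a)) x)
decode-removeTop []          a       ()
decode-removeTop (zero ∷ T)  zero    ()
decode-removeTop (suc h ∷ T) zero    _   x = decode-grow h T x
decode-removeTop (h ∷ T)     (suc a) pos =
  decode-cons h _ _ (lift-nonzero T (suc a) _ (λ e → <⇒≢ pos (sym e))) (lift-nonzero T (suc a) _ (λ ()))
                (λ y → decode-removeTop T a pos (suc y))

-- The flight path moves from row b to row b or b+1 of the next column to the
-- left (as b < h or not); this is skip h read one row higher.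
skip-row : ∀ h b → skip h (suc b) ≡ suc (if b <ᵇ h then b else suc b)
skip-row zero    b    = refl
skip-row (suc h) zero = refl
skip-row (suc h) (suc b) rewrite skip-row h b with b <ᵇ h
... | true  = refl
... | false = refl

firstCell-++ : ∀ T a b ys → firstCell (flightPath T (suc a) b ++ ys) ≡ firstCell (flightPath T (suc a) b)
firstCell-++ T zero    b ys = refl
firstCell-++ T (suc a) b ys =
  trans (cong firstCell (++-assoc F (z ∷ []) ys))
        (trans (firstCell-++ T a b′ (z ∷ ys)) (sym (firstCell-++ T a b′ (z ∷ []))))
  where
  b′ = if b <ᵇ height T (suc a) then b else suc b
  F  = flightPath T (suc a) b′
  z  = (suc (suc a) , b)

flightNumber-lift : ∀ T a b → sl (firstCell (flightPath T (suc a) b)) ≡ lift T (suc a) (suc b)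
flightNumber-lift T zero    b = refl
flightNumber-lift T (suc a) b =
  trans (cong sl (firstCell-++ T a b′ ((suc (suc a) , b) ∷ [])))
   (trans (flightNumber-lift T a b′)
    (trans (cong (lift T (suc a)) (sym (skip-row (height T (suc a)) b)))
           (sym (lift-step T a (suc b)))))
  where
  b′ = if b <ᵇ height T (suc a) then b else suc b

dropLast-∷ʳ : ∀ {A : Set} (xs : List A) y → dropLast (xs ∷ʳ y) ≡ xs
dropLast-∷ʳ []            y = refl
dropLast-∷ʳ (x ∷ [])      y = refl
dropLast-∷ʳ (x ∷ x′ ∷ xs) y = cong (x ∷_) (dropLast-∷ʳ (x′ ∷ xs) y)

flightPath-last : ∀ T a b → flightPath T (suc a) b ≡ dropLast (flightPath T (suc a) b) ∷ʳ (suc a , b)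
flightPath-last T zero    b = refl
flightPath-last T (suc a) b =
  cong (_∷ʳ (suc (suc a) , b))
    (sym (dropLast-∷ʳ (flightPath T (suc a) (if b <ᵇ height T (suc a) then b else suc b)) (suc (suc a) , b)))

hookStep-skip : ∀ D c b n →
  skip (height D c) (suc (suc (b + n))) ≡
  suc (suc ((if b <ᵇ height D c then b else suc b) +
            hookStep D (c , (if b <ᵇ height D c then b else suc b)) n))
hookStep-skip D c b n with b <ᵇ height D c in eq
... | true with b <? height D c
...   | no b≮h = ⊥-elim (b≮h (<ᵇ⇒< b (height D c) (subst IsTrue (sym eq) _)))
...   | yes b<h with n <? (height D c ∸ suc b)
...     | yes n<above = skip-below (height D c) _
          (subst (_≤ height D c) (cong suc (trans (+-suc n b) (cong suc (+-comm n b))))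
             (m≤o∸n⇒m+n≤o (suc n) b<h n<above))
...     | no n≮above = trans (skip-above (height D c) _ (s≤s (≤-trans (m≤n+m∸n (height D c) (suc b))
                              (+-monoʳ-≤ (suc b) (≮⇒≥ n≮above)))))
                         (cong (λ z → suc (suc z)) (sym (+-suc b n)))
hookStep-skip D c b n | false with suc b <? height D c
... | yes b+1<h = ⊥-elim (subst IsTrue eq (<⇒<ᵇ (<-trans (n<1+n b) b+1<h)))
... | no _ = skip-above (height D c) _
               (s≤s (≤-trans (≮⇒≥ (λ lt → subst IsTrue eq (<⇒<ᵇ lt))) (≤-trans (m≤m+n b n) (n≤1+n _))))

hookNumber-lift : ∀ T a b n →
  suc (foldr (hookStep T) n (dropLast (flightPath T (suc a) b)) + lift T (suc a) (suc b))
    ≡ lift T (suc a) (suc (suc (b + n)))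
hookNumber-lift T zero    b n = cong suc (trans (+-suc n b) (cong suc (+-comm n b)))
hookNumber-lift T (suc a) b n = begin
    suc (foldr f n (dropLast (F ∷ʳ z)) + lift T (suc (suc a)) (suc b))
  ≡⟨ cong (λ w → suc (w + lift T (suc (suc a)) (suc b))) unfold ⟩
    suc (foldr f n′ (dropLast F) + lift T (suc (suc a)) (suc b))
  ≡⟨ cong (λ w → suc (foldr f n′ (dropLast F) + w))
       (trans (lift-step T a (suc b)) (cong (lift T (suc a)) (skip-row (height T (suc a)) b))) ⟩
    suc (foldr f n′ (dropLast F) + lift T (suc a) (suc b′))
  ≡⟨ hookNumber-lift T a b′ n′ ⟩
    lift T (suc a) (suc (suc (b′ + n′)))
  ≡⟨ cong (lift T (suc a)) (sym (hookStep-skip T (suc a) b n)) ⟩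
    lift T (suc a) (skip (height T (suc a)) (suc (suc (b + n))))
  ≡⟨ sym (lift-step T a _) ⟩
    lift T (suc (suc a)) (suc (suc (b + n)))
  ∎
  where
  open ≡-Reasoning
  f  = hookStep T
  b′ = if b <ᵇ height T (suc a) then b else suc b
  F  = flightPath T (suc a) b′
  z  = (suc (suc a) , b)
  n′ = hookStep T (suc a , b′) n
  unfold : foldr f n (dropLast (F ∷ʳ z)) ≡ foldr f n′ (dropLast F)
  unfold = trans (cong (foldr f n) (dropLast-∷ʳ F z))
            (trans (cong (foldr f n) (flightPath-last T a b′)) (foldr-∷ʳ f n (suc a , b′) (dropLast F)))

topCell-transposition : ∀ T c → IsTopCell T c →
  (1 ≤ fn T c) × (fn T c ≤ hn T c) ×
  (∀ x → decode T x ≡ transp (fn T c) (suc (hn T c)) (decode (T -ᶜ c) x))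
topCell-transposition T (zero , b) (() , _)
topCell-transposition T (suc a , .(height T (suc a) ∸ 1)) (s≤s z≤n , pos , refl) =
  1≤i , m≤n+m i hooks , λ x →
    trans (decode-removeTop T a pos x)
          (cong₂ (λ u w → transp u w (decode (removeTop T (suc a)) x)) (sym i≡lift) (sym j+1≡lift))
  where
  H = height T (suc a)
  i = fn T (suc a , H ∸ 1)
  hooks = foldr (hookStep T) 0 (dropLast (flightPath T (suc a) (H ∸ 1)))
  H-1+1 : suc (H ∸ 1) ≡ H
  H-1+1 = trans (+-comm 1 (H ∸ 1)) (m∸n+n≡m pos)
  i≡lift : i ≡ lift T (suc a) H
  i≡lift = trans (flightNumber-lift T a (H ∸ 1)) (cong (lift T (suc a)) H-1+1)
  j+1≡lift : suc (hooks + i) ≡ lift T (suc a) (suc H)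
  j+1≡lift = trans (cong (λ z → suc (hooks + z)) (flightNumber-lift T a (H ∸ 1)))
    (trans (hookNumber-lift T a (H ∸ 1) 0)
           (cong (λ z → lift T (suc a) (suc z)) (trans (cong suc (+-identityʳ (H ∸ 1))) H-1+1)))
  1≤i : 1 ≤ i
  1≤i = n≢0⇒n>0 (λ e → lift-nonzero T (suc a) H (λ e′ → <⇒≢ pos (sym e′)) (trans (sym i≡lift) e))

proposition4p1 : (T : Diagram) (c : Cell) → IsTopCell T c →
    (hookSlide (fn T c) (hn T c) (T -ᶜ c) ≈ᵀ T) ×
    ((ω : ℕ → ℕ) → TowerOfPerm ω (T -ᶜ c) →
      TowerOfPerm (λ x → ω (transp (fn T c) (suc (hn T c)) x)) T)
proposition4p1 T c top with topCell-transposition T c top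
... | 1≤i , i≤j , remove = hook-restores , tower-grows
  where
  t = transp (fn T c) (suc (hn T c))
  hw = hookWord (fn T c) (hn T c)
  hook-restores : hookSlide (fn T c) (hn T c) (T -ᶜ c) ≈ᵀ T
  hook-restores = decode-injective _ T λ x →
    trans (hookSlide-decode _ _ (T -ᶜ c) 1≤i i≤j x) (sym (remove x))
  -- If β spells ω ∘ t then β followed by the hook word spells ω.
  tower-grows : (ω : ℕ → ℕ) → TowerOfPerm ω (T -ᶜ c) → TowerOfPerm (λ x → ω (t x)) T
  tower-grows ω tower β β-red@(β-pos , β≗ωt , _) =
    inverse⇒towerOfPerm _ T (λ x → trans (cong (λ v → ω (t v)) (remove x))
      (trans (cong ω (transp-involutive _ _ _)) (ω∘decode x))) β β-red
    where
    βhw≗ω : wordPerm (β ++ hw) ≗ₚ ω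
    βhw≗ω x = trans (wordPerm-++ β hw x)
      (trans (β≗ωt _) (cong ω (trans (cong t (hookWord-perm _ _ i≤j x)) (transp-involutive _ _ x))))
    ω∘decode : ∀ x → ω (decode (T -ᶜ c) x) ≡ x
    ω∘decode = towerOfPerm⇒inverse ω _ (β ++ hw) (++⁺ β-pos (hookWord-positive _ _ 1≤i)) βhw≗ω tower
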